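{- Let $\mathscr C$ be a class of graphs such that for every $r$ there exists $k$ such that Pseudo-Flipper wins the Pseudo-Flipper game of radius $r$ on any $G\in\mathscr C$ in at most $k$ rounds. Then $\mathscr C$ is flip-wide.
   Context: For a partition $\mathcal P$ of $V(G)$, a $\mathcal P$-flip of $G$ is obtained by choosing a set of unordered pairs $\{P,Q\}$ of parts ($P=Q$ allowed) and complementing adjacency between all distinct $u\in P,w\in Q$. $B^{r}_{\mathcal P}(c)$ is the set of vertices $w$ with $\mathrm{dist}_H(c,w)\le r$ for every $\mathcal P$-flip $H$ of $G$. Pseudo-Flipper game of radius $r$ on $G$: $A_0=V(G)$, $\mathcal F_0=\{V(G)\}$; in round $k\ge1$: if $|A_{k-1}|=1$ Pseudo-Flipper wins; else Connector picks $c_k\in A_{k-1}$ and $A_k:=A_{k-1}\cap B^r_{\mathcal F_{k-1}}(c_k)$ (in the original $G$); then Pseudo-Flipper obtains $\mathcal F_k$ by splitting one part of $\mathcal F_{k-1}$ into two nonempty disjoint parts. An atomic flip $(A,B)$ complements adjacency of all distinct $u,v$ with $u\in A,v\in B$ or $u\in B,v\in A$; $G\oplus F$ applies all flips of a set $F$. $\mathscr C$ is flip-wide if for every $r$ there are $s_r\in\mathbb N$ and $N_r:\mathbb N\to\mathbb N$ such that for all $m$, $G\in\mathscr C$ and $A\subseteq V(G)$ with $|A|\ge N_r(m)$ there exist a set $F$ of at most $s_r$ atomic flips and $B\subseteq A$, $|B|\ge m$, whose vertices are pairwise at distance $>r$ in $G\oplus F$. -}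

module Defs where

open import Data.Nat using (ℕ; zero; suc; _≤_; _≥_)
open import Data.Bool using (Bool; true; false; _xor_; _∧_; _∨_; not; T)
open import Data.Fin using (Fin; _≟_; fromℕ; inject₁)
open import Data.Fin.Subset using (Subset; ∣_∣) renaming (_∈_ to _∈ₛ_; _⊆_ to _⊆ₛ_)
open import Data.List using (List; []; _∷_; length)
open import Data.Product using (Σ; ∃; ∃-syntax; _×_; _,_)
open import Data.Sum using (_⊎_)
open import Data.Empty using (⊥)
open import Relation.Nullary using (¬_; does)
open import Relation.Binary.PropositionalEquality using (_≡_; _≢_)
open import Level using (0ℓ) renaming (suc to lsuc)

record Graph : Set where
  field
    n     : ℕ
    adj   : Fin n → Fin n → Bool
    sym   : ∀ u v → adj u v ≡ adj v u
    irrefl : ∀ u → adj u u ≡ false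
open Graph public

GraphClass : Set₁
GraphClass = Graph → Set

-- Walks: Reach adj r u v  iff  dist(u,v) ≤ r in the graph with adjacency adj
-- (distance is ∞ between different components).
data Reach {n : ℕ} (adj : Fin n → Fin n → Bool) : ℕ → Fin n → Fin n → Set where
  here : ∀ {r u} → Reach adj r u u
  step : ∀ {r u w v} → T (adj u w) → Reach adj r w v → Reach adj (suc r) u v

distinct : ∀ {n} → Fin n → Fin n → Bool
distinct u v = not (does (u ≟ v))

-- Partitions of Fin n, given as labellings by part indices Fin m.

-- P-flip: a symmetric choice S of (unordered) pairs of parts {P,Q}
-- (P = Q allowed); adjacency between distinct u ∈ P, w ∈ Q is complemented.
flipAdj : ∀ {m} (G : Graph) → (Fin (n G) → Fin m) → (Fin m → Fin m → Bool)
        → Fin (n G) → Fin (n G) → Bool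
flipAdj G p S u v = adj G u v xor (S (p u) (p v) ∧ distinct u v)

Ball : ∀ {m} (G : Graph) → ℕ → (Fin (n G) → Fin m) → Fin (n G) → Fin (n G) → Set
Ball {m} G r p c w =
  (S : Fin m → Fin m → Bool) → (∀ i j → S i j ≡ S j i) → Reach (flipAdj G p S) r c w

Arena : ℕ → Set₁
Arena n = Fin n → Set

Singleton : ∀ {n} → Arena n → Set
Singleton {n} A = Σ (Fin n) λ x → A x × (∀ y → A y → y ≡ x)

-- p' arises from p by splitting part i into the two nonempty disjoint parts
-- X and (part i minus X); X receives the new label m.
SplitOf : ∀ {N m} → (Fin N → Fin m) → (Fin N → Fin (suc m)) → Set
SplitOf {N} {m} p p' =
  Σ (Fin m) λ i → Σ (Fin N → Bool) λ X →
      (∀ v → T (X v) → p v ≡ i)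
    × (∃[ v ] T (X v))
    × (∃[ v ] (p v ≡ i × X v ≡ false))
    × (∀ v → p' v ≡ (if X v then fromℕ m else inject₁ (p v)))
  where open import Data.Bool using (if_then_else_)

-- PFWins G r k A p : in the position with arena A and partition p,
-- Pseudo-Flipper can force a win within at most k further rounds
-- (the win is declared at the start of a round in which |A| = 1).
PFWins : (G : Graph) (r : ℕ) → ℕ → ∀ {m} → Arena (n G) → (Fin (n G) → Fin m) → Set
PFWins G r zero    A p = ⊥
PFWins G r (suc k) {m} A p =
  Singleton A ⊎
  ((c : Fin (n G)) → A c →
     Σ (Fin (n G) → Fin (suc m)) λ p' → SplitOf p p' ×
       PFWins G r k (λ w → A w × Ball G r p c w) p')

-- Pseudo-Flipper wins the game of radius r on G in at most k rounds:
-- initial arena V(G), initial partition {V(G)} (everything labelled 0).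
PFWinsGame : Graph → ℕ → ℕ → Set
PFWinsGame G r k = PFWins G r k {1} (λ _ → Data.Unit.⊤) (λ _ → Data.Fin.zero)
  where import Data.Unit; import Data.Fin

AtomicFlip : ℕ → Set
AtomicFlip N = Subset N × Subset N

atomicFlipAdj : ∀ {N} → AtomicFlip N → (Fin N → Fin N → Bool) → Fin N → Fin N → Bool
atomicFlipAdj (A , B) e u v =
  e u v xor ((((u ∈ᵇ A) ∧ (v ∈ᵇ B)) ∨ ((u ∈ᵇ B) ∧ (v ∈ᵇ A))) ∧ distinct u v)
  where
    open import Data.Vec using (lookup)
    _∈ᵇ_ : ∀ {N} → Fin N → Subset N → Bool
    x ∈ᵇ S = lookup S x

applyFlips : ∀ {N} → List (AtomicFlip N) → (Fin N → Fin N → Bool) → Fin N → Fin N → Bool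
applyFlips []      e = e
applyFlips (f ∷ F) e = atomicFlipAdj f (applyFlips F e)

FlipWide : GraphClass → Set
FlipWide C =
  (r : ℕ) → Σ ℕ λ s → Σ (ℕ → ℕ) λ N →
    (m : ℕ) (G : Graph) → C G → (A : Subset (n G)) → ∣ A ∣ ≥ N m →
      Σ (List (AtomicFlip (n G))) λ F → length F ≤ s ×
      Σ (Subset (n G)) λ B → B ⊆ₛ A × ∣ B ∣ ≥ m ×
        (∀ u v → u ∈ₛ B → v ∈ₛ B → u ≢ v → ¬ Reach (applyFlips F (adj G)) r u v)

{-# OPTIONS --safe #-}
-- Play the game of radius 2r against a large vertex set X and maintain X as a
-- subset of the arena. In a round with current partition into q parts, treat
-- the finitely many P-flips one at a time: in each flip, either X contains m
-- vertices pairwise at distance > r (and we are done, with a flip of a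
-- partition into at most k + 1 parts, i.e. at most k + 1 atomic flips), or a
-- large part of X lies in one r-ball. Shrinking X through all flips leaves a
-- large X in which any two vertices are at distance ≤ 2r in every flip, so X
-- lies inside B^{2r}(c) for whatever c Connector plays next. Pseudo-Flipper
-- wins within k rounds, so the arena becomes a singleton while X still has at
-- least two elements: the first alternative must occur.
module Submission where

open import Defs hiding (sym)
open import Data.Nat using (ℕ; zero; suc; _+_; _*_; _^_; _≤_; _<_; z≤n; s≤s)
open import Data.Nat.Properties
  using (≤-refl; ≤-trans; m≤m+n; m≤n+m; m≤n*m; m^n≢0; +-suc; +-identityʳ; *-identityˡ; *-assoc;
         ≤-reflexive; _≤?_; ≰⇒>; +-mono-<; <⇒≱)
open import Data.Bool using (Bool; true; false; _xor_; _∧_; _∨_; T)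
open import Data.Bool.Properties
  using (xor-identityʳ; xor-assoc; xor-comm; ∧-distribʳ-xor; ∨-idem; ∨-comm)
open import Data.Fin using (Fin; zero; suc; combine; remQuot)
open import Data.Fin.Properties using (remQuot-combine)
import Data.Fin.Properties as Fin
open import Data.Fin.Subset using (Subset; ∣_∣; ⁅_⁆; _∪_; _∩_; ∁; Nonempty)
  renaming (_∈_ to _∈ₛ_; _⊆_ to _⊆ₛ_; ⊥ to ∅)
open import Data.Fin.Subset.Properties
  using (x∈⁅x⁆; x∈⁅y⁆⇒x≡y; ∉⊥; x∈p∪q⁻; x∈p∪q⁺; x∈p∩q⁻; p∩q⊆p; p⊆p∪q; x∈∁p⇒x∉p;
         p⊆q⇒∣p∣≤∣q∣; p⊂q⇒∣p∣<∣q∣; ∣⁅x⁆∣≡1; ∣⊥∣≡0; nonempty?; Empty-unique)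
open import Data.Vec using (Vec; []; _∷_; lookup; tabulate)
open import Data.Vec.Properties using (lookup∘tabulate; []=⇒lookup; lookup⇒[]=)
open import Data.List using (List; []; _∷_; length; map; _++_)
open import Data.List.Properties using (length-map; length-++)
open import Data.List.Membership.Propositional using (_∈_)
open import Data.List.Membership.Propositional.Properties using (∈-map⁺; ∈-++⁺ˡ; ∈-++⁺ʳ)
open import Data.List.Relation.Unary.Any using (here; there)
open import Data.Maybe using (Maybe; just; nothing)
open import Data.Product using (Σ; ∃-syntax; Σ-syntax; _×_; _,_; proj₁; proj₂; uncurry)
open import Data.Sum using (_⊎_; inj₁; inj₂)
open import Data.Unit using (⊤; tt)
open import Function using (_∘_)
open import Relation.Nullary using (¬_; Dec; yes; no; does; contradiction)
open import Relation.Nullary.Decidable using (_×-dec_; T?; dec-true)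
open import Relation.Unary using (Decidable)
open import Relation.Binary.PropositionalEquality
  using (_≡_; _≢_; refl; sym; trans; cong; cong₂; subst; module ≡-Reasoning)

Adjacency : ℕ → Set
Adjacency N = Fin N → Fin N → Bool

Symmetric : ∀ {N} → Adjacency N → Set
Symmetric e = ∀ u v → e u v ≡ e v u

module _ {N} {e : Adjacency N} where

  reach-mono : ∀ {r r' u v} → r ≤ r' → Reach e r u v → Reach e r' u v
  reach-mono _          here       = here
  reach-mono (s≤s r≤r') (step a p) = step a (reach-mono r≤r' p)

  reach-snoc : ∀ {r u w v} → Reach e r u w → T (e w v) → Reach e (suc r) u v
  reach-snoc here       a = step a here
  reach-snoc (step b p) a = step b (reach-snoc p a)

  reach-trans : ∀ {r s u w v} → Reach e r u w → Reach e s w v → Reach e (r + s) u v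
  reach-trans {r} {s} here q = reach-mono (m≤n+m s r) q
  reach-trans (step a p) q = step a (reach-trans p q)

  reach-sym : Symmetric e → ∀ {r u v} → Reach e r u v → Reach e r v u
  reach-sym e-sym here                         = here
  reach-sym e-sym (step {u = u} {w = w} a p) = reach-snoc (reach-sym e-sym p) (subst T (e-sym u w) a)

reach-cong : ∀ {N} {e e' : Adjacency N} → (∀ u v → e u v ≡ e' u v) →
             ∀ {r u v} → Reach e r u v → Reach e' r u v
reach-cong e≗e' here                         = here
reach-cong e≗e' (step {u = u} {w = w} a p) = step (subst T (e≗e' u w) a) (reach-cong e≗e' p)

reach? : ∀ {N} (e : Adjacency N) r u v → Dec (Reach e r u v)
reach? e r u v with u Fin.≟ v
... | yes refl = yes here
reach? e zero    u v | no u≢v = no λ { here → u≢v refl }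
reach? e (suc r) u v | no u≢v with Fin.any? (λ w → T? (e u w) ×-dec reach? e r w v)
... | yes (w , a , p) = yes (step a p)
... | no ∄w           = no λ { here → u≢v refl ; (step a p) → ∄w (_ , a , p) }

∣p∣≡∣p∩q∣+∣p∩∁q∣ : ∀ {N} (p q : Subset N) → ∣ p ∣ ≡ ∣ p ∩ q ∣ + ∣ p ∩ ∁ q ∣
∣p∣≡∣p∩q∣+∣p∩∁q∣ []          []          = refl
∣p∣≡∣p∩q∣+∣p∩∁q∣ (true ∷ p)  (true ∷ q)  = cong suc (∣p∣≡∣p∩q∣+∣p∩∁q∣ p q)
∣p∣≡∣p∩q∣+∣p∩∁q∣ (true ∷ p)  (false ∷ q) =
  trans (cong suc (∣p∣≡∣p∩q∣+∣p∩∁q∣ p q)) (sym (+-suc ∣ p ∩ q ∣ ∣ p ∩ ∁ q ∣))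
∣p∣≡∣p∩q∣+∣p∩∁q∣ (false ∷ p) (_ ∷ q)     = ∣p∣≡∣p∩q∣+∣p∩∁q∣ p q

nonempty-if-∣p∣≥1 : ∀ {N} (p : Subset N) → 1 ≤ ∣ p ∣ → Nonempty p
nonempty-if-∣p∣≥1 {N} p 1≤∣p∣ with nonempty? p
... | yes ne = ne
... | no ¬ne with Empty-unique ¬ne
... | refl = contradiction (≤-trans 1≤∣p∣ (≤-reflexive (∣⊥∣≡0 N))) λ ()

+-≤-cancel-< : ∀ {a b c d} → a + b ≤ c + d → c < a → b ≤ d
+-≤-cancel-< {b = b} {d = d} ab≤cd c<a with b ≤? d
... | yes b≤d = b≤d
... | no  b≰d = contradiction ab≤cd (<⇒≱ (+-mono-< c<a (≰⇒> b≰d)))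

module _ {N} {P : Fin N → Set} (P? : Decidable P) where

  subsetOf : Subset N
  subsetOf = tabulate (does ∘ P?)

  ∈-subsetOf⁺ : ∀ {x} → P x → x ∈ₛ subsetOf
  ∈-subsetOf⁺ {x} px = lookup⇒[]= x subsetOf (trans (lookup∘tabulate (does ∘ P?) x) (dec-true (P? x) px))

  ∈-subsetOf⁻ : ∀ {x} → x ∈ₛ subsetOf → P x
  ∈-subsetOf⁻ {x} x∈ with P? x | trans (sym (lookup∘tabulate (does ∘ P?) x)) ([]=⇒lookup x∈)
  ... | yes px | _  = px
  ... | no _   | ()

Scattered : ∀ {N} → Adjacency N → ℕ → Subset N → Set
Scattered e r B = ∀ u v → u ∈ₛ B → v ∈ₛ B → u ≢ v → ¬ Reach e r u v

scattered-cong : ∀ {N} {e e' : Adjacency N} {r B} → (∀ u v → e u v ≡ e' u v) →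
                 Scattered e' r B → Scattered e r B
scattered-cong e≗e' B-scattered u v u∈B v∈B u≢v = B-scattered u v u∈B v∈B u≢v ∘ reach-cong e≗e'

ScatteredSubset : ∀ {N} → Adjacency N → ℕ → ℕ → Subset N → Set
ScatteredSubset e r m X = Σ[ B ∈ Subset _ ] B ⊆ₛ X × m ≤ ∣ B ∣ × Scattered e r B

WithinRadius : ∀ {N} → Adjacency N → ℕ → Fin N → Subset N → Set
WithinRadius e r c Y = ∀ y → y ∈ₛ Y → Reach e r y c

ball : ∀ {N} → Adjacency N → ℕ → Fin N → Subset N
ball e r c = subsetOf (λ v → reach? e r v c)

ClusteredSubset : ∀ {N} → Adjacency N → ℕ → ℕ → Subset N → Set
ClusteredSubset e r t X = Σ[ c ∈ Fin _ ] Σ[ Y ∈ Subset _ ] Y ⊆ₛ X × t ≤ ∣ Y ∣ × WithinRadius e r c Y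

scattered-∪-⁅⁆ : ∀ {N} {e : Adjacency N} {r B x} → Symmetric e → Scattered e r B →
                 (∀ v → v ∈ₛ B → ¬ Reach e r v x) → Scattered e r (B ∪ ⁅ x ⁆)
scattered-∪-⁅⁆ {B = B} {x} e-sym B-scattered far-from-x u v u∈ v∈ u≢v
  with x∈p∪q⁻ B ⁅ x ⁆ u∈ | x∈p∪q⁻ B ⁅ x ⁆ v∈
... | inj₁ u∈B | inj₁ v∈B = B-scattered u v u∈B v∈B u≢v
... | inj₁ u∈B | inj₂ v∈x rewrite x∈⁅y⁆⇒x≡y x v∈x = far-from-x u u∈B
... | inj₂ u∈x | inj₁ v∈B rewrite x∈⁅y⁆⇒x≡y x u∈x = far-from-x v v∈B ∘ reach-sym e-sym
... | inj₂ u∈x | inj₂ v∈x =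
  contradiction (trans (x∈⁅y⁆⇒x≡y x u∈x) (sym (x∈⁅y⁆⇒x≡y x v∈x))) u≢v

-- Induction on m: pick x ∈ X; either its r-ball already holds t vertices of X,
-- or the rest of X is still large and x is far from all of it.
scattered-or-clustered : ∀ {N} (e : Adjacency N) → Symmetric e → ∀ r m t (X : Subset N) →
  1 ≤ t → suc m * t ≤ ∣ X ∣ → ScatteredSubset e r m X ⊎ ClusteredSubset e r t X
scattered-or-clustered e e-sym r zero t X _ _ =
  inj₁ (∅ , (λ x∈∅ → contradiction x∈∅ ∉⊥) , z≤n , λ u _ u∈∅ → contradiction u∈∅ ∉⊥)
scattered-or-clustered e e-sym r (suc m) t X 1≤t big
  with nonempty-if-∣p∣≥1 X (≤-trans 1≤t (≤-trans (m≤m+n t _) big))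
... | x , x∈X with t ≤? ∣ X ∩ ball e r x ∣
... | yes t≤∣near∣ =
  inj₂ (x , X ∩ ball e r x , p∩q⊆p X _ , t≤∣near∣ ,
        λ y y∈ → ∈-subsetOf⁻ (λ v → reach? e r v x) (proj₂ (x∈p∩q⁻ X _ y∈)))
... | no t≰∣near∣
  with scattered-or-clustered e e-sym r m t (X ∩ ∁ (ball e r x)) 1≤t
         (+-≤-cancel-< (subst (t + suc m * t ≤_) (∣p∣≡∣p∩q∣+∣p∩∁q∣ X (ball e r x)) big)
                       (≰⇒> t≰∣near∣))
... | inj₂ (c , Y , Y⊆far , t≤∣Y∣ , Y-near-c) =
  inj₂ (c , Y , p∩q⊆p X _ ∘ Y⊆far , t≤∣Y∣ , Y-near-c)
... | inj₁ (B , B⊆far , m≤∣B∣ , B-scattered) =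
  inj₁ (B ∪ ⁅ x ⁆ , B∪x⊆X , ≤-trans (s≤s m≤∣B∣) ∣B∣<∣B∪x∣ ,
        scattered-∪-⁅⁆ e-sym B-scattered far)
  where
  far : ∀ v → v ∈ₛ B → ¬ Reach e r v x
  far v v∈B near =
    x∈∁p⇒x∉p (proj₂ (x∈p∩q⁻ X _ (B⊆far v∈B))) (∈-subsetOf⁺ (λ w → reach? e r w x) near)
  B∪x⊆X : B ∪ ⁅ x ⁆ ⊆ₛ X
  B∪x⊆X v∈ with x∈p∪q⁻ B ⁅ x ⁆ v∈
  ... | inj₁ v∈B = p∩q⊆p X _ (B⊆far v∈B)
  ... | inj₂ v∈x rewrite x∈⁅y⁆⇒x≡y x v∈x = x∈X
  ∣B∣<∣B∪x∣ : ∣ B ∣ < ∣ B ∪ ⁅ x ⁆ ∣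
  ∣B∣<∣B∪x∣ = p⊂q⇒∣p∣<∣q∣ (p⊆p∪q ⁅ x ⁆ , x , x∈p∪q⁺ (inj₂ (x∈⁅x⁆ x)) , λ x∈B → far x x∈B here)

scattered-or-clusteredAll : ∀ {N} {I : Set} (E : I → Adjacency N) → (∀ i → Symmetric (E i)) →
  ∀ r m (is : List I) t (X : Subset N) → 1 ≤ t → suc m ^ length is * t ≤ ∣ X ∣ →
  (Σ[ i ∈ I ] ScatteredSubset (E i) r m X) ⊎
  (Σ[ Y ∈ Subset N ] Y ⊆ₛ X × t ≤ ∣ Y ∣ × (∀ i → i ∈ is → ∃[ c ] WithinRadius (E i) r c Y))
scattered-or-clusteredAll E E-sym r m [] t X _ big =
  inj₂ (X , (λ x∈ → x∈) , subst (_≤ ∣ X ∣) (*-identityˡ t) big , λ _ ())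
scattered-or-clusteredAll E E-sym r m (i ∷ is) t X 1≤t big
  with scattered-or-clustered (E i) (E-sym i) r m (suc m ^ length is * t) X
         (≤-trans 1≤t (m≤n*m t (suc m ^ length is) {{m^n≢0 (suc m) (length is)}}))
         (subst (_≤ ∣ X ∣) (*-assoc (suc m) (suc m ^ length is) t) big)
... | inj₁ scattered = inj₁ (i , scattered)
... | inj₂ (c , Y , Y⊆X , ∣Y∣≥ , Y-near-c)
  with scattered-or-clusteredAll E E-sym r m is t Y 1≤t ∣Y∣≥
... | inj₁ (j , B , B⊆Y , rest) = inj₁ (j , B , Y⊆X ∘ B⊆Y , rest)
... | inj₂ (Z , Z⊆Y , t≤∣Z∣ , clustered) = inj₂ (Z , Y⊆X ∘ Z⊆Y , t≤∣Z∣ , clustered′)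
  where
  clustered′ : ∀ j → j ∈ i ∷ is → ∃[ c ] WithinRadius (E j) r c Z
  clustered′ j (here refl) = c , λ z z∈Z → Y-near-c z (Z⊆Y z∈Z)
  clustered′ j (there j∈) = clustered j j∈

distinct-sym : ∀ {N} (u v : Fin N) → distinct u v ≡ distinct v u
distinct-sym u v with u Fin.≟ v | v Fin.≟ u
... | yes _   | yes _   = refl
... | no _    | no _    = refl
... | yes u≡v | no v≢u  = contradiction (sym u≡v) v≢u
... | no u≢v  | yes v≡u = contradiction (sym v≡u) u≢v

module _ (G : Graph) {q} (p : Fin (n G) → Fin q) where

  flipAdj-sym : ∀ S → (∀ i j → S i j ≡ S j i) → Symmetric (flipAdj G p S)
  flipAdj-sym S S-sym u v =
    cong₂ _xor_ (Graph.sym G u v) (cong₂ _∧_ (S-sym (p u) (p v)) (distinct-sym u v))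

  flipAdj-cong : ∀ {S S'} → (∀ i j → S i j ≡ S' i j) → ∀ u v → flipAdj G p S u v ≡ flipAdj G p S' u v
  flipAdj-cong S≗S' u v = cong (λ b → adj G u v xor (b ∧ distinct u v)) (S≗S' (p u) (p v))

symmetrize : ∀ {A : Set} → (A → A → Bool) → A → A → Bool
symmetrize S i j = S i j ∨ S j i

symmetrize-sym : ∀ {A : Set} (S : A → A → Bool) i j → symmetrize S i j ≡ symmetrize S j i
symmetrize-sym S i j = ∨-comm (S i j) (S j i)

symmetrize-of-sym : ∀ {A : Set} (S : A → A → Bool) → (∀ i j → S i j ≡ S j i) →
                    ∀ i j → symmetrize S i j ≡ S i j
symmetrize-of-sym S S-sym i j = trans (cong (S i j ∨_) (S-sym j i)) (∨-idem (S i j))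

matrix : ∀ {q} → Vec Bool (q * q) → Fin q → Fin q → Bool
matrix v i j = lookup v (combine i j)

encode : ∀ {q} → (Fin q → Fin q → Bool) → Vec Bool (q * q)
encode {q} S = tabulate (uncurry S ∘ remQuot q)

matrix-encode : ∀ {q} (S : Fin q → Fin q → Bool) i j → matrix (encode S) i j ≡ S i j
matrix-encode {q} S i j =
  trans (lookup∘tabulate (uncurry S ∘ remQuot q) (combine i j)) (cong (uncurry S) (remQuot-combine i j))

bitVectors : ∀ l → List (Vec Bool l)
bitVectors zero    = [] ∷ []
bitVectors (suc l) = map (true ∷_) (bitVectors l) ++ map (false ∷_) (bitVectors l)

∈-bitVectors : ∀ {l} (v : Vec Bool l) → v ∈ bitVectors l
∈-bitVectors []          = here refl
∈-bitVectors (true ∷ v)  = ∈-++⁺ˡ (∈-map⁺ (true ∷_) (∈-bitVectors v))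
∈-bitVectors (false ∷ v) = ∈-++⁺ʳ (map (true ∷_) (bitVectors _)) (∈-map⁺ (false ∷_) (∈-bitVectors v))

length-bitVectors : ∀ l → length (bitVectors l) ≡ 2 ^ l
length-bitVectors zero    = refl
length-bitVectors (suc l) = begin
  length (map (true ∷_) vs ++ map (false ∷_) vs)    ≡⟨ length-++ (map (true ∷_) vs) ⟩
  length (map (true ∷_) vs) + length (map (false ∷_) vs)
    ≡⟨ cong₂ _+_ (length-map (true ∷_) vs) (length-map (false ∷_) vs) ⟩
  length vs + length vs                             ≡⟨ cong₂ _+_ (length-bitVectors l) (length-bitVectors l) ⟩
  2 ^ l + 2 ^ l                                     ≡⟨ cong (2 ^ l +_) (sym (+-identityʳ (2 ^ l))) ⟩
  2 ^ suc l                                         ∎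
  where
  open ≡-Reasoning
  vs = bitVectors l

threshold : ℕ → ℕ → ℕ → ℕ
threshold m zero    q = 2
threshold m (suc k) q = suc m ^ 2 ^ (q * q) * threshold m k (suc q)

2≤threshold : ∀ m k q → 2 ≤ threshold m k q
2≤threshold m zero    q = ≤-refl
2≤threshold m (suc k) q =
  ≤-trans (2≤threshold m k (suc q)) (m≤n*m _ (suc m ^ 2 ^ (q * q)) {{m^n≢0 (suc m) (2 ^ (q * q))}})

∣p∣≤1-if-Singleton : ∀ {N} {A : Arena N} (X : Subset N) → Singleton A →
                     (∀ {x} → x ∈ₛ X → A x) → ∣ X ∣ ≤ 1
∣p∣≤1-if-Singleton X (x , _ , unique) X⊆A =
  ≤-trans (p⊆q⇒∣p∣≤∣q∣ (λ {y} y∈X → subst (_∈ₛ ⁅ x ⁆) (sym (unique y (X⊆A y∈X))) (x∈⁅x⁆ x)))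
          (≤-reflexive (∣⁅x⁆∣≡1 x))

module Game (G : Graph) (r m : ℕ) where

  private
    N : ℕ
    N = n G

  flipOf : ∀ {q} → (Fin N → Fin q) → Vec Bool (q * q) → Adjacency N
  flipOf p v = flipAdj G p (symmetrize (matrix v))

  flipOf-sym : ∀ {q} (p : Fin N → Fin q) v → Symmetric (flipOf p v)
  flipOf-sym p v = flipAdj-sym G p _ (symmetrize-sym (matrix v))

  flipOf-encode : ∀ {q} (p : Fin N → Fin q) S → (∀ i j → S i j ≡ S j i) →
                  ∀ u v → flipOf p (encode S) u v ≡ flipAdj G p S u v
  flipOf-encode p S S-sym = flipAdj-cong G p λ i j →
    trans (cong₂ _∨_ (matrix-encode S i j) (matrix-encode S j i)) (symmetrize-of-sym S S-sym i j)

  record ScatteredFlip (bound : ℕ) (X : Subset N) : Set where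
    field
      parts        : ℕ
      parts≤bound  : parts ≤ bound
      partition    : Fin N → Fin parts
      relation     : Fin parts → Fin parts → Bool
      relation-sym : ∀ i j → relation i j ≡ relation j i
      scattered    : ScatteredSubset (flipAdj G partition relation) r m X

  ScatteredFlip-mono : ∀ {b b' X X'} → b ≤ b' → X ⊆ₛ X' → ScatteredFlip b X → ScatteredFlip b' X'
  ScatteredFlip-mono b≤b' X⊆X' s = record
    { parts = parts ; parts≤bound = ≤-trans parts≤bound b≤b' ; partition = partition
    ; relation = relation ; relation-sym = relation-sym
    ; scattered = let (B , B⊆X , rest) = scattered in B , X⊆X' ∘ B⊆X , rest
    }
    where open ScatteredFlip s

  ball-if-clustered : ∀ {q} (p : Fin N → Fin q) {Y} →
    (∀ v → v ∈ bitVectors (q * q) → ∃[ c ] WithinRadius (flipOf p v) r c Y) →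
    ∀ {x y} → x ∈ₛ Y → y ∈ₛ Y → Ball G (r + r) p x y
  ball-if-clustered p clustered x∈Y y∈Y S S-sym =
    reach-cong (flipOf-encode p S S-sym)
      (reach-trans (near _ x∈Y) (reach-sym (flipOf-sym p (encode S)) (near _ y∈Y)))
    where near = proj₂ (clustered (encode S) (∈-bitVectors (encode S)))

  -- The new partition need not be a split of the old one for this argument:
  -- all that matters is that it has one more part, which its type records.
  scatteredFlip : ∀ k {q} (A : Arena N) (p : Fin N → Fin q) → PFWins G (r + r) k A p →
    (X : Subset N) → (∀ {x} → x ∈ₛ X → A x) → threshold m k q ≤ ∣ X ∣ → ScatteredFlip (q + k) X
  scatteredFlip zero A p () X X⊆A big
  scatteredFlip (suc k) {q} A p (inj₁ singleton) X X⊆A big =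
    contradiction (≤-trans (2≤threshold m (suc k) q) big)
                  (<⇒≱ (s≤s (∣p∣≤1-if-Singleton X singleton X⊆A)))
  scatteredFlip (suc k) {q} A p (inj₂ strategy) X X⊆A big
    with scattered-or-clusteredAll (flipOf p) (flipOf-sym p) r m (bitVectors (q * q))
           (threshold m k (suc q)) X
           (≤-trans (s≤s z≤n) (2≤threshold m k (suc q)))
           (subst (λ L → suc m ^ L * threshold m k (suc q) ≤ ∣ X ∣) (sym (length-bitVectors (q * q))) big)
  ... | inj₁ (v , scattered) = record
    { parts = q ; parts≤bound = m≤m+n q (suc k) ; partition = p ; relation = symmetrize (matrix v)
    ; relation-sym = symmetrize-sym (matrix v) ; scattered = scattered }
  ... | inj₂ (Y , Y⊆X , ∣Y∣≥ , clustered)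
    with nonempty-if-∣p∣≥1 Y (≤-trans (s≤s z≤n) (≤-trans (2≤threshold m k (suc q)) ∣Y∣≥))
  ... | x , x∈Y with strategy x (X⊆A (Y⊆X x∈Y))
  ... | p' , _ , win =
    ScatteredFlip-mono (≤-reflexive (sym (+-suc q k))) Y⊆X
      (scatteredFlip k _ p' win Y
         (λ y∈Y → X⊆A (Y⊆X y∈Y) , ball-if-clustered p clustered x∈Y y∈Y) ∣Y∣≥)

-- A flip of a partition into q parts is a composition of q atomic flips

flipped : ∀ {N} → List (AtomicFlip N) → Fin N → Fin N → Bool
flipped []            u v = false
flipped ((P , Q) ∷ F) u v = ((lookup P u ∧ lookup Q v) ∨ (lookup Q u ∧ lookup P v)) xor flipped F u v

applyFlips-flipped : ∀ {N} F (e : Adjacency N) u v →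
                     applyFlips F e u v ≡ e u v xor (flipped F u v ∧ distinct u v)
applyFlips-flipped []            e u v = sym (xor-identityʳ (e u v))
applyFlips-flipped ((P , Q) ∷ F) e u v = begin
  applyFlips F e u v xor (c ∧ d)  ≡⟨ cong (_xor (c ∧ d)) (applyFlips-flipped F e u v) ⟩
  (e u v xor (f ∧ d)) xor (c ∧ d) ≡⟨ xor-assoc (e u v) (f ∧ d) (c ∧ d) ⟩
  e u v xor ((f ∧ d) xor (c ∧ d)) ≡⟨ cong (e u v xor_) (xor-comm (f ∧ d) (c ∧ d)) ⟩
  e u v xor ((c ∧ d) xor (f ∧ d)) ≡⟨ cong (e u v xor_) (sym (∧-distribʳ-xor d c f)) ⟩
  e u v xor ((c xor f) ∧ d)       ∎
  where
  open ≡-Reasoning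
  c = (lookup P u ∧ lookup Q v) ∨ (lookup Q u ∧ lookup P v)
  d = distinct u v
  f = flipped F u v

-- A vertex labelled nothing lies in no part and is never flipped.
onLabels : ∀ {p} → (Fin p → Fin p → Bool) → Maybe (Fin p) → Maybe (Fin p) → Bool
onLabels S (just i) (just j) = S i j
onLabels S _        _        = false

isZero : ∀ {p} → Maybe (Fin (suc p)) → Bool
isZero (just zero) = true
isZero _           = false

predLabel : ∀ {p} → Maybe (Fin (suc p)) → Maybe (Fin p)
predLabel (just (suc i)) = just i
predLabel _              = nothing

-- Part zero is flipped against its whole row at once; the other parts are
-- then handled recursively with part zero relabelled nothing.
labelFlips : ∀ {N} p → (Fin N → Maybe (Fin p)) → (Fin p → Fin p → Bool) → List (AtomicFlip N)
labelFlips zero    ℓ S = []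
labelFlips (suc p) ℓ S =
  (tabulate (isZero ∘ ℓ) , tabulate (onLabels S (just zero) ∘ ℓ)) ∷
  labelFlips p (predLabel ∘ ℓ) (λ i j → S (suc i) (suc j))

length-labelFlips : ∀ {N} p (ℓ : Fin N → Maybe (Fin p)) S → length (labelFlips p ℓ S) ≡ p
length-labelFlips zero    ℓ S = refl
length-labelFlips (suc p) ℓ S = cong suc (length-labelFlips p _ _)

onLabels-peelZero : ∀ {p} (S : Fin (suc p) → Fin (suc p) → Bool) → (∀ i j → S i j ≡ S j i) → ∀ a b →
  ((isZero a ∧ onLabels S (just zero) b) ∨ (onLabels S (just zero) a ∧ isZero b))
    xor onLabels (λ i j → S (suc i) (suc j)) (predLabel a) (predLabel b)
  ≡ onLabels S a b
onLabels-peelZero S S-sym nothing b = refl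
onLabels-peelZero S S-sym (just zero) nothing with S zero zero
... | true  = refl
... | false = refl
onLabels-peelZero S S-sym (just zero) (just zero) with S zero zero
... | true  = refl
... | false = refl
onLabels-peelZero S S-sym (just zero) (just (suc j)) with S zero (suc j) | S zero zero
... | true  | _     = refl
... | false | true  = refl
... | false | false = refl
onLabels-peelZero S S-sym (just (suc i)) nothing with S zero (suc i)
... | true  = refl
... | false = refl
onLabels-peelZero S S-sym (just (suc i)) (just zero) rewrite S-sym (suc i) zero with S zero (suc i)
... | true  = refl
... | false = refl
onLabels-peelZero S S-sym (just (suc i)) (just (suc j)) with S zero (suc i)
... | true  = refl
... | false = refl

flipped-labelFlips : ∀ {N} p (ℓ : Fin N → Maybe (Fin p)) S → (∀ i j → S i j ≡ S j i) →
                     ∀ u v → flipped (labelFlips p ℓ S) u v ≡ onLabels S (ℓ u) (ℓ v)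
flipped-labelFlips zero ℓ S _ u v with ℓ u
... | nothing = refl
flipped-labelFlips (suc p) ℓ S S-sym u v
  rewrite lookup∘tabulate (isZero ∘ ℓ) u | lookup∘tabulate (isZero ∘ ℓ) v
        | lookup∘tabulate (onLabels S (just zero) ∘ ℓ) u
        | lookup∘tabulate (onLabels S (just zero) ∘ ℓ) v
        | flipped-labelFlips p (predLabel ∘ ℓ) (λ i j → S (suc i) (suc j))
                             (λ i j → S-sym (suc i) (suc j)) u v
  = onLabels-peelZero S S-sym (ℓ u) (ℓ v)

applyFlips-partitionFlip : ∀ (G : Graph) {q} (p : Fin (n G) → Fin q) S → (∀ i j → S i j ≡ S j i) →
  ∀ u v → applyFlips (labelFlips q (just ∘ p) S) (adj G) u v ≡ flipAdj G p S u v
applyFlips-partitionFlip G {q} p S S-sym u v =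
  trans (applyFlips-flipped (labelFlips q (just ∘ p) S) (adj G) u v)
        (cong (λ b → adj G u v xor (b ∧ distinct u v)) (flipped-labelFlips q (just ∘ p) S S-sym u v))

atomicFlips-if-ScatteredFlip : ∀ (G : Graph) {r m bound X} → Game.ScatteredFlip G r m bound X →
  Σ (List (AtomicFlip (n G))) λ F → length F ≤ bound × ScatteredSubset (applyFlips F (adj G)) r m X
atomicFlips-if-ScatteredFlip G s =
  labelFlips parts (just ∘ partition) relation ,
  ≤-trans (≤-reflexive (length-labelFlips parts _ relation)) parts≤bound ,
  let (B , B⊆X , m≤∣B∣ , B-scattered) = scattered
  in B , B⊆X , m≤∣B∣ , scattered-cong (applyFlips-partitionFlip G partition relation relation-sym) B-scattered
  where open Game.ScatteredFlip s

mainTheorem10 : (C : GraphClass) →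
    ((r : ℕ) → Σ ℕ λ k → (G : Graph) → C G → PFWinsGame G r k) →
    FlipWide C
mainTheorem10 C hyp r = suc k , (λ m → threshold m k 1) , λ m G G∈C A ∣A∣≥ →
  atomicFlips-if-ScatteredFlip G
    (Game.scatteredFlip G r m k (λ _ → ⊤) (λ _ → zero) (proj₂ (hyp (r + r)) G G∈C)
                        A (λ _ → tt) ∣A∣≥)
  where
  k = proj₁ (hyp (r + r))
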